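{- There are deterministic algorithms which, given the vertex set $V(G)$ of an $n$-vertex graph $G$ (whose edges are unknown) and positive integers $t$ and $k$, solve Decision-Cut using $\mathcal{O}(k^{\mathcal{O}(1)}\log n)$ queries to a BIS oracle for $G$, and solve Cut using $\mathcal{O}(k^{\mathcal{O}(1)}\log n)$ queries to a BISE oracle for $G$. Here Cut asks to output a partition $V_1\uplus\dots\uplus V_t$ of $V(G)$ such that at least $k$ edges have endpoints in different parts if such a partition exists, and otherwise to report that none exists; Decision-Cut asks to decide whether such a partition exists.
   Context: The BIS oracle takes two disjoint non-empty subsets $A,B\subseteq V(G)$ and answers whether some edge of $G$ has one endpoint in $A$ and the other in $B$. The BISE oracle takes the same input and returns such an edge (an arbitrary one) if one exists, and NULL otherwise. Only oracle queries are counted. -}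

module Defs where

open import Data.Bool using (Bool; true; false; if_then_else_; _∧_; not)
open import Data.Nat using (ℕ; zero; suc; _≤_; _<ᵇ_; _+_; _*_; _^_)
open import Data.Nat.Logarithm using (⌈log₂_⌉)
open import Data.Fin using (Fin; toℕ; _≟_)
open import Data.Fin.Subset using (Subset; _∈_; _∩_; Nonempty; Empty)
open import Data.List using (List; map; allFin)
open import Data.Nat.ListAction using (sum)
open import Data.Maybe using (Maybe; just; nothing)
open import Data.Product using (Σ; ∃; _×_; _,_)
open import Relation.Nullary using (¬_)
open import Relation.Nullary.Decidable using (⌊_⌋)
open import Relation.Binary.PropositionalEquality using (_≡_)

record Graph (n : ℕ) : Set where
  field
    adj    : Fin n → Fin n → Bool
    sym    : ∀ u v → adj u v ≡ adj v u
    irrefl : ∀ u → adj u u ≡ false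
open Graph public

ValidQuery : ∀ {n} → Subset n → Subset n → Set
ValidQuery A B = Nonempty A × Nonempty B × Empty (A ∩ B)

EdgeBetween : ∀ {n} → Graph n → Subset n → Subset n → Set
EdgeBetween G A B = ∃ λ a → ∃ λ b → a ∈ A × b ∈ B × adj G a b ≡ true

-- Deterministic adaptive query algorithms (decision trees) with a BIS oracle.
data BISAlg (n : ℕ) (R : Set) : Set where
  ret : R → BISAlg n R
  ask : Subset n → Subset n → (Bool → BISAlg n R) → BISAlg n R

-- Deterministic adaptive query algorithms with a BISE oracle.
-- The answer is either an edge (a , b) with a ∈ A, b ∈ B, or NULL (nothing).
data BISEAlg (n : ℕ) (R : Set) : Set where
  ret : R → BISEAlg n R
  ask : Subset n → Subset n → (Maybe (Fin n × Fin n) → BISEAlg n R) → BISEAlg n R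

BISAnswer : ∀ {n} → Graph n → Subset n → Subset n → Bool → Set
BISAnswer G A B true  = EdgeBetween G A B
BISAnswer G A B false = ¬ EdgeBetween G A B

BISEAnswer : ∀ {n} → Graph n → Subset n → Subset n → Maybe (Fin n × Fin n) → Set
BISEAnswer G A B (just (a , b)) = a ∈ A × b ∈ B × adj G a b ≡ true
BISEAnswer G A B nothing        = ¬ EdgeBetween G A B

-- RunsWithin G P alg m : on every execution of alg against a (possibly adversarial)
-- correct oracle for G, every query is valid, at most m queries are made, and the
-- output satisfies P.
data BISRunsWithin {n} {R : Set} (G : Graph n) (P : R → Set) : BISAlg n R → ℕ → Set where
  ret : ∀ {r m} → P r → BISRunsWithin G P (ret r) m
  ask : ∀ {A B k m} → ValidQuery A B →
        (∀ ans → BISAnswer G A B ans → BISRunsWithin G P (k ans) m) →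
        BISRunsWithin G P (ask A B k) (suc m)

data BISERunsWithin {n} {R : Set} (G : Graph n) (P : R → Set) : BISEAlg n R → ℕ → Set where
  ret : ∀ {r m} → P r → BISERunsWithin G P (ret r) m
  ask : ∀ {A B k m} → ValidQuery A B →
        (∀ ans → BISEAnswer G A B ans → BISERunsWithin G P (k ans) m) →
        BISERunsWithin G P (ask A B k) (suc m)

-- Number of edges {u,v} of G whose endpoints lie in different parts of p
-- (each unordered edge counted once, via toℕ u < toℕ v).
cutSize : ∀ {n t} → Graph n → (Fin n → Fin t) → ℕ
cutSize {n} G p =
  sum (map (λ u → sum (map (λ v →
        if (toℕ u <ᵇ toℕ v) ∧ adj G u v ∧ not ⌊ p u ≟ p v ⌋ then 1 else 0)
      (allFin n))) (allFin n))

-- A partition V₁ ⊎ … ⊎ Vₜ (part i = p ⁻¹(i)) with at least k crossing edges.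
GoodCut : ∀ {n} → Graph n → (t k : ℕ) → (Fin n → Fin t) → Set
GoodCut G t k p = k ≤ cutSize G p

CutExists : ∀ {n} → Graph n → (t k : ℕ) → Set
CutExists G t k = ∃ λ p → GoodCut G t k p

DecisionCutCorrect : ∀ {n} → Graph n → (t k : ℕ) → Bool → Set
DecisionCutCorrect G t k true  = CutExists G t k
DecisionCutCorrect G t k false = ¬ CutExists G t k

CutCorrect : ∀ {n} → Graph n → (t k : ℕ) → Maybe (Fin n → Fin t) → Set
CutCorrect G t k (just p) = GoodCut G t k p
CutCorrect G t k nothing  = ¬ CutExists G t k

-- The query bound c · k^d · (⌈log₂ n⌉ + 1), i.e. O(k^{O(1)} log n).
queryBound : (c d k n : ℕ) → ℕ
queryBound c d k n = c * k ^ d * (⌈log₂ n ⌉ + 1)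

module Submission where

-- The Cut algorithm uses the BISE oracle in three phases.  Phase 1 greedily
-- grows a matching M among the unmatched vertices; an edge inside a vertex set
-- is found with ⌈log₂ n⌉ queries, one per bit of the vertex indices.  If k
-- matching edges are found, putting the second endpoint of each into part 1
-- cuts all of them.  Otherwise the unmatched vertices are independent, so the
-- at most 2k matched vertices cover every edge, and Phase 2 lists the
-- neighbours of each of them, one query per neighbour: a vertex with k
-- neighbours yields a star cut, and otherwise all edges are now known and
-- Phase 3 searches all partitions exhaustively.  This makes O(k log n + k²)
-- queries, O(k²) of them answered by an edge.  For Decision-Cut, each BISE
-- query is simulated by a BIS query followed, after a positive answer, by two
-- binary searches over the bits (2⌈log₂ n⌉ queries) locating an edge.

open import Defs renaming (sym to adj-sym; irrefl to adj-irrefl)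
open import Data.Bool using (Bool; true; false; if_then_else_; _∧_; _∨_; not; T)
open import Data.Bool.Properties using (T-≡; not-injective)
open import Function.Bundles using (Equivalence)
open import Data.Nat
  using (ℕ; zero; suc; _+_; _*_; _^_; _≤_; _<_; _≥_; z≤n; s≤s; z<s; s<s; _<ᵇ_; _≤?_; ⌊_/2⌋; ⌈_/2⌉)
open import Data.Nat.Properties
  using (≤-refl; ≤-reflexive; ≤-trans; <-≤-trans; ≤-<-trans; <-irrefl; ≤∧≢⇒<; ≮⇒≥; <⇒<ᵇ;
         m≤m+n; m≤n+m; n≤1+n; m<1+n⇒m<n∨m≡n; m≤n⇒m<n∨m≡n; n<1⇒n≡0;
         +-suc; +-identityʳ; *-suc; +-mono-≤; +-monoˡ-≤; +-monoʳ-≤; *-monoˡ-≤; *-monoʳ-≤; *-cancelˡ-<;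
         ⌊n/2⌋+⌈n/2⌉≡n; ⌊n/2⌋≤⌈n/2⌉; ⌈n/2⌉<n; module ≤-Reasoning)
open import Data.Nat.Induction using (<-wellFounded)
open import Data.Nat.Logarithm using (⌈log₂_⌉)
open import Data.Nat.Logarithm.Core using (⌈log2⌉)
open import Data.Nat.Tactic.RingSolver using (solve-∀)
open import Induction.WellFounded using (Acc; acc)
open import Data.Fin using (Fin; zero; suc; toℕ; _≟_)
open import Data.Fin.Properties using (toℕ-injective; toℕ<n; any?)
open import Data.Fin.Subset using (Subset; _∈_; _∩_; ⁅_⁆; Nonempty; Empty)
open import Data.Fin.Subset.Properties using (nonempty?; x∈p∩q⁺; x∈p∩q⁻; x∈⁅x⁆; x∈⁅y⁆⇒x≡y)
open import Data.Maybe using (Maybe; just; nothing; is-just)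
open import Data.Vec using (tabulate)
open import Data.Vec.Properties using (lookup∘tabulate; []=⇒lookup; lookup⇒[]=)
open import Data.List using (List; []; _∷_; map; allFin; length; _++_)
open import Data.List.Properties using (map-cong; length-map)
open import Data.Nat.ListAction using (sum)
open import Data.List.Membership.Propositional using () renaming (_∈_ to _∈ˡ_; _∉_ to _∉ˡ_)
open import Data.List.Membership.Propositional.Properties using (∈-allFin; ∈-map⁺; ∈-++⁺ˡ; ∈-++⁺ʳ)
open import Data.List.Relation.Unary.Any using (here; there)
open import Data.List.Relation.Unary.All as All using (All; []; _∷_)
open import Data.List.Relation.Unary.All.Properties as All using (¬Any⇒All¬)
open import Data.List.Relation.Unary.AllPairs as AllPairs using (AllPairs; []; _∷_)
import Data.List.Relation.Unary.AllPairs.Properties as AllPairs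
open import Data.Product using (Σ; ∃; _×_; _,_; proj₁; proj₂; swap)
open import Data.Product.Properties using (≡-dec)
open import Data.Empty using (⊥; ⊥-elim)
open import Data.Sum using (_⊎_; inj₁; inj₂)
open import Relation.Nullary using (¬_; Dec; yes; no; does)
open import Relation.Nullary.Decidable using (⌊_⌋; dec-true; dec-false)
open import Relation.Binary.PropositionalEquality
  using (_≡_; _≢_; refl; sym; trans; cong; cong₂; subst; module ≡-Reasoning)

-- Binary digits.  Binary search over the bits of vertex indices rests on:
-- distinct vertices of an n-vertex graph differ in one of their first
-- ⌈log₂ n⌉ bits.

odd : ℕ → Bool
odd 0             = false
odd 1             = true
odd (suc (suc x)) = odd x

digitValue : Bool → ℕ
digitValue false = 0
digitValue true  = 1

halving : ∀ x → x ≡ digitValue (odd x) + 2 * ⌊ x /2⌋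
halving 0             = refl
halving 1             = refl
halving (suc (suc x)) = begin
  2 + x                                  ≡⟨ cong (2 +_) (halving x) ⟩
  2 + (digitValue (odd x) + 2 * ⌊ x /2⌋) ≡⟨ shift (digitValue (odd x)) ⌊ x /2⌋ ⟩
  digitValue (odd x) + 2 * suc ⌊ x /2⌋   ∎
  where
    open ≡-Reasoning
    shift : ∀ b h → 2 + (b + 2 * h) ≡ b + 2 * suc h
    shift = solve-∀

digit : ℕ → ℕ → Bool
digit zero    x = odd x
digit (suc i) x = digit i ⌊ x /2⌋

half-< : ∀ L x → x < 2 ^ suc L → ⌊ x /2⌋ < 2 ^ L
half-< L x x< = *-cancelˡ-< 2 ⌊ x /2⌋ (2 ^ L) (≤-<-trans twice-half≤x x<)
  where
    twice-half≤x : 2 * ⌊ x /2⌋ ≤ x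
    twice-half≤x = subst (2 * ⌊ x /2⌋ ≤_) (sym (halving x)) (m≤n+m (2 * ⌊ x /2⌋) (digitValue (odd x)))

digits-injective : ∀ L x y → x < 2 ^ L → y < 2 ^ L →
                   (∀ i → i < L → digit i x ≡ digit i y) → x ≡ y
digits-injective zero    x y x<1 y<1 _    = trans (n<1⇒n≡0 x<1) (sym (n<1⇒n≡0 y<1))
digits-injective (suc L) x y x<  y<  same = begin
  x                                ≡⟨ halving x ⟩
  digitValue (odd x) + 2 * ⌊ x /2⌋ ≡⟨ cong₂ (λ b h → digitValue b + 2 * h) (same 0 z<s) halves ⟩
  digitValue (odd y) + 2 * ⌊ y /2⌋ ≡⟨ sym (halving y) ⟩
  y                                ∎
  where
    open ≡-Reasoning
    halves : ⌊ x /2⌋ ≡ ⌊ y /2⌋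
    halves = digits-injective L ⌊ x /2⌋ ⌊ y /2⌋ (half-< L x x<) (half-< L y y<)
               (λ i i<L → same (suc i) (s<s i<L))

n≤2^⌈log₂n⌉ : ∀ n → n ≤ 2 ^ ⌈log₂ n ⌉
n≤2^⌈log₂n⌉ n = bound n (<-wellFounded n)
  where
    open ≤-Reasoning
    twice-half : ∀ m → m ≤ 2 * ⌈ m /2⌉
    twice-half m = begin
      m                   ≡⟨ sym (⌊n/2⌋+⌈n/2⌉≡n m) ⟩
      ⌊ m /2⌋ + ⌈ m /2⌉   ≤⟨ +-monoˡ-≤ ⌈ m /2⌉ (⌊n/2⌋≤⌈n/2⌉ m) ⟩
      ⌈ m /2⌉ + ⌈ m /2⌉   ≡⟨ cong (⌈ m /2⌉ +_) (sym (+-identityʳ ⌈ m /2⌉)) ⟩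
      2 * ⌈ m /2⌉         ∎
    bound : ∀ m (ac : Acc _<_ m) → m ≤ 2 ^ ⌈log2⌉ m ac
    bound 0             _        = z≤n
    bound 1             _        = s≤s z≤n
    bound (suc (suc m)) (acc rs) = begin
      2 + m            ≤⟨ +-monoʳ-≤ 2 (twice-half m) ⟩
      2 + 2 * ⌈ m /2⌉  ≡⟨ sym (*-suc 2 ⌈ m /2⌉) ⟩
      2 * suc ⌈ m /2⌉  ≤⟨ *-monoʳ-≤ 2 (bound (suc ⌈ m /2⌉) (rs (⌈n/2⌉<n m))) ⟩
      2 * 2 ^ ⌈log2⌉ (suc ⌈ m /2⌉) (rs (⌈n/2⌉<n m)) ∎

bit : ∀ {n} → ℕ → Fin n → Bool
bit i x = digit i (toℕ x)

bits-separate : ∀ {n} (x y : Fin n) → (∀ i → i < ⌈log₂ n ⌉ → bit i x ≡ bit i y) → x ≡ y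
bits-separate {n} x y same =
  toℕ-injective (digits-injective ⌈log₂ n ⌉ (toℕ x) (toℕ y) (below x) (below y) same)
  where
    below : (z : Fin n) → toℕ z < 2 ^ ⌈log₂ n ⌉
    below z = <-≤-trans (toℕ<n z) (n≤2^⌈log₂n⌉ n)

⟦_⟧ : ∀ {n} → (Fin n → Bool) → Subset n
⟦ f ⟧ = tabulate f

∈⟦⟧⁺ : ∀ {n} {f : Fin n → Bool} {x} → f x ≡ true → x ∈ ⟦ f ⟧
∈⟦⟧⁺ {f = f} {x} fx = lookup⇒[]= x (tabulate f) (trans (lookup∘tabulate f x) fx)

∈⟦⟧⁻ : ∀ {n} {f : Fin n → Bool} {x} → x ∈ ⟦ f ⟧ → f x ≡ true
∈⟦⟧⁻ {f = f} {x} x∈ = trans (sym (lookup∘tabulate f x)) ([]=⇒lookup x∈)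

not-does⁺ : ∀ {P : Set} (d : Dec P) → ¬ P → not (does d) ≡ true
not-does⁺ (yes p) ¬p = ⊥-elim (¬p p)
not-does⁺ (no _)  _  = refl

not-does⁻ : ∀ {P : Set} (d : Dec P) → not (does d) ≡ true → ¬ P
not-does⁻ (no ¬p) _ = ¬p

withBit : ∀ {n} → ℕ → Bool → Subset n
withBit i true  = ⟦ bit i ⟧
withBit i false = ⟦ (λ x → not (bit i x)) ⟧

slice : ∀ {n} → Subset n → ℕ → Bool → Subset n
slice U i b = U ∩ withBit i b

slice⁺ : ∀ {n} {U : Subset n} i {b x} → x ∈ U → bit i x ≡ b → x ∈ slice U i b
slice⁺ i {true}  x∈U eq = x∈p∩q⁺ (x∈U , ∈⟦⟧⁺ eq)
slice⁺ i {false} x∈U eq = x∈p∩q⁺ (x∈U , ∈⟦⟧⁺ (cong not eq))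

slice⁻ : ∀ {n} (U : Subset n) i b {x} → x ∈ slice U i b → x ∈ U × bit i x ≡ b
slice⁻ U i true  x∈ = proj₁ (x∈p∩q⁻ U _ x∈) , ∈⟦⟧⁻ (proj₂ (x∈p∩q⁻ U _ x∈))
slice⁻ U i false x∈ =
  proj₁ (x∈p∩q⁻ U _ x∈) , not-injective (∈⟦⟧⁻ (proj₂ (x∈p∩q⁻ U _ x∈)))

slice-⊆ : ∀ {n} (U : Subset n) i b {x} → x ∈ slice U i b → x ∈ U
slice-⊆ U i b x∈ = proj₁ (slice⁻ U i b x∈)

slices-disjoint : ∀ {n} (X Y : Subset n) i → Empty (slice X i true ∩ slice Y i false)
slices-disjoint X Y i (x , x∈)
  with trans (sym (proj₂ (slice⁻ X i true (proj₁ (x∈p∩q⁻ _ _ x∈)))))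
             (proj₂ (slice⁻ Y i false (proj₂ (x∈p∩q⁻ _ _ x∈))))
... | ()

disjoint-⊆ : ∀ {n} {X Y Y' : Subset n} → Empty (X ∩ Y) → (∀ {z} → z ∈ Y' → z ∈ Y) →
             Empty (X ∩ Y')
disjoint-⊆ {X = X} {Y} {Y'} disjoint Y'⊆Y (z , z∈) =
  disjoint (z , x∈p∩q⁺ (proj₁ (x∈p∩q⁻ X Y' z∈) , Y'⊆Y (proj₂ (x∈p∩q⁻ X Y' z∈))))

-- Counting cut edges.  A list of k cut edges, pairwise distinct as unordered
-- pairs, certifies that a partition cuts at least k edges.

sum-mono : ∀ {A : Set} {f g : A → ℕ} xs → (∀ x → f x ≤ g x) → sum (map f xs) ≤ sum (map g xs)
sum-mono []       f≤g = z≤n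
sum-mono (x ∷ xs) f≤g = +-mono-≤ (f≤g x) (sum-mono xs f≤g)

sum-mono-< : ∀ {A : Set} {f g : A → ℕ} {a} xs → (∀ x → f x ≤ g x) → a ∈ˡ xs → f a < g a →
             sum (map f xs) < sum (map g xs)
sum-mono-< (x ∷ xs) f≤g (here refl) fa<ga = +-mono-≤ fa<ga (sum-mono xs f≤g)
sum-mono-< {f = f} {g} (x ∷ xs) f≤g (there a∈) fa<ga =
  subst (_≤ g x + sum (map g xs)) (+-suc (f x) (sum (map f xs)))
        (+-mono-≤ (f≤g x) (sum-mono-< xs f≤g a∈ fa<ga))

doubleSum : ∀ {n} → (Fin n → Fin n → ℕ) → ℕ
doubleSum {n} g = sum (map (λ u → sum (map (g u) (allFin n))) (allFin n))

doubleSum-cong : ∀ {n} {g h : Fin n → Fin n → ℕ} → (∀ u v → g u v ≡ h u v) →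
                 doubleSum g ≡ doubleSum h
doubleSum-cong {n} g≡h =
  cong sum (map-cong (λ u → cong sum (map-cong (g≡h u) (allFin n))) (allFin n))

_≟²_ : ∀ {n} (e e' : Fin n × Fin n) → Dec (e ≡ e')
_≟²_ = ≡-dec _≟_ _≟_

erase : ∀ {n} → (Fin n → Fin n → ℕ) → Fin n × Fin n → Fin n → Fin n → ℕ
erase g e u v with (u , v) ≟² e
... | yes _ = 0
... | no  _ = g u v

erase-≤ : ∀ {n} (g : Fin n → Fin n → ℕ) e u v → erase g e u v ≤ g u v
erase-≤ g e u v with (u , v) ≟² e
... | yes _ = z≤n
... | no  _ = ≤-refl

erase-elsewhere : ∀ {n} (g : Fin n → Fin n → ℕ) e {u v} → (u , v) ≢ e → erase g e u v ≡ g u v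
erase-elsewhere g e {u} {v} uv≢e with (u , v) ≟² e
... | yes uv≡e = ⊥-elim (uv≢e uv≡e)
... | no  _    = refl

erase-< : ∀ {n} (g : Fin n → Fin n → ℕ) a b → 1 ≤ g a b →
          doubleSum (erase g (a , b)) < doubleSum g
erase-< {n} g a b pos =
  sum-mono-< (allFin n) (λ u → sum-mono (allFin n) (erase-≤ g (a , b) u)) (∈-allFin a)
    (sum-mono-< (allFin n) (erase-≤ g (a , b) a) (∈-allFin b) erased)
  where
    erased : erase g (a , b) a b < g a b
    erased with (a , b) ≟² (a , b)
    ... | yes _ = pos
    ... | no ne = ⊥-elim (ne refl)

distinct-positive≤doubleSum : ∀ {n} (g : Fin n → Fin n → ℕ) (E : List (Fin n × Fin n)) →
  All (λ e → 1 ≤ g (proj₁ e) (proj₂ e)) E → AllPairs _≢_ E → length E ≤ doubleSum g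
distinct-positive≤doubleSum g []            _            _                  = z≤n
distinct-positive≤doubleSum g ((a , b) ∷ E) (pos ∷ poss) (fresh ∷ distinct) =
  ≤-trans (s≤s (distinct-positive≤doubleSum (erase g (a , b)) E (still-positive poss fresh) distinct))
          (erase-< g a b pos)
  where
    still-positive : ∀ {E} → All (λ e → 1 ≤ g (proj₁ e) (proj₂ e)) E → All ((a , b) ≢_) E →
                     All (λ e → 1 ≤ erase g (a , b) (proj₁ e) (proj₂ e)) E
    still-positive []           []           = []
    still-positive (pos ∷ poss) (ne ∷ fresh) =
      subst (1 ≤_) (sym (erase-elsewhere g (a , b) (λ eq → ne (sym eq)))) pos ∷ still-positive poss fresh

edge-ends-differ : ∀ {n} (G : Graph n) {a b} → adj G a b ≡ true → a ≢ b
edge-ends-differ G {a} ab refl with trans (sym ab) (adj-irrefl G a)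
... | ()

-- The number of edges of an adjacency function f that the partition p cuts;
-- cutSize G p is cutCount (adj G) p by definition.
crossing : ∀ {n t} → (Fin n → Fin n → Bool) → (Fin n → Fin t) → Fin n → Fin n → ℕ
crossing f p u v = if (toℕ u <ᵇ toℕ v) ∧ f u v ∧ not ⌊ p u ≟ p v ⌋ then 1 else 0

cutCount : ∀ {n t} → (Fin n → Fin n → Bool) → (Fin n → Fin t) → ℕ
cutCount f p = doubleSum (crossing f p)

cutCount-cong : ∀ {n t} {f f' : Fin n → Fin n → Bool} {p q : Fin n → Fin t} →
                (∀ u v → f u v ≡ f' u v) → (∀ x → p x ≡ q x) → cutCount f p ≡ cutCount f' q
cutCount-cong {f = f} {f'} {p} {q} f≡f' p≡q = doubleSum-cong same
  where
    same : ∀ u v → crossing f p u v ≡ crossing f' q u v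
    same u v rewrite f≡f' u v | p≡q u | p≡q v = refl

CutEdge : ∀ {n t} → Graph n → (Fin n → Fin t) → Fin n × Fin n → Set
CutEdge G p (a , b) = adj G a b ≡ true × p a ≢ p b

_≢ᵤ_ : ∀ {n} → Fin n × Fin n → Fin n × Fin n → Set
(a , b) ≢ᵤ (c , d) = (a , b) ≢ (c , d) × (a , b) ≢ (d , c)

-- The orientation in which cutSize counts an edge: smaller index first.
orient : ∀ {n} → Fin n × Fin n → Fin n × Fin n
orient (a , b) = if toℕ a <ᵇ toℕ b then (a , b) else (b , a)

orient-≢ : ∀ {n} {e e' : Fin n × Fin n} → e ≢ᵤ e' → orient e ≢ orient e'
orient-≢ {e = a , b} {c , d} (ne , ne-swapped) with toℕ a <ᵇ toℕ b | toℕ c <ᵇ toℕ d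
... | true  | true  = ne
... | true  | false = ne-swapped
... | false | true  = λ eq → ne-swapped (cong swap eq)
... | false | false = λ eq → ne (cong swap eq)

<ᵇ-flip : ∀ {m n} → m ≢ n → (m <ᵇ n) ≡ false → (n <ᵇ m) ≡ true
<ᵇ-flip {m} {n} m≢n m≮n =
  Equivalence.to T-≡ (<⇒<ᵇ (≤∧≢⇒< n≤m (λ eq → m≢n (sym eq))))
  where
    n≤m : n ≤ m
    n≤m = ≮⇒≥ (λ m<n → subst T m≮n (<⇒<ᵇ m<n))

module _ {n t} (G : Graph n) (p : Fin n → Fin t) where

  counted : ∀ {u v} → (toℕ u <ᵇ toℕ v) ≡ true → CutEdge G p (u , v) → 1 ≤ crossing (adj G) p u v
  counted {u} {v} u<v (uv , pu≢pv) rewrite u<v | uv with p u ≟ p v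
  ... | yes pu≡pv = ⊥-elim (pu≢pv pu≡pv)
  ... | no  _     = s≤s z≤n

  orient-counted : ∀ {e} → CutEdge G p e → 1 ≤ crossing (adj G) p (proj₁ (orient e)) (proj₂ (orient e))
  orient-counted {a , b} (ab , pa≢pb) with toℕ a <ᵇ toℕ b in a<b
  ... | true  = counted a<b (ab , pa≢pb)
  ... | false = counted (<ᵇ-flip (λ eq → edge-ends-differ G ab (toℕ-injective eq)) a<b)
                        (trans (adj-sym G b a) ab , λ eq → pa≢pb (sym eq))

  cut-lower-bound : (E : List (Fin n × Fin n)) → All (CutEdge G p) E → AllPairs _≢ᵤ_ E →
                    length E ≤ cutSize G p
  cut-lower-bound E cut distinct = subst (_≤ cutSize G p) (length-map orient E)
    (distinct-positive≤doubleSum (crossing (adj G) p) (map orient E)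
      (All.map⁺ (All.map orient-counted cut)) (AllPairs.map⁺ (AllPairs.map orient-≢ distinct)))

one-part-cuts-nothing : ∀ {n} (G : Graph n) (p : Fin n → Fin 1) → cutSize G p ≡ 0
one-part-cuts-nothing {n} G p = trans (doubleSum-cong uncut) doubleSum-zero
  where
    uncut : ∀ u v → crossing (adj G) p u v ≡ 0
    uncut u v with p u | p v
    ... | zero | zero with toℕ u <ᵇ toℕ v | adj G u v
    ...   | false | _     = refl
    ...   | true  | false = refl
    ...   | true  | true  = refl
    sum-zeros : ∀ {A : Set} (xs : List A) → sum (map (λ _ → 0) xs) ≡ 0
    sum-zeros []       = refl
    sum-zeros (_ ∷ xs) = sum-zeros xs
    doubleSum-zero : doubleSum {n} (λ _ _ → 0) ≡ 0
    doubleSum-zero =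
      trans (cong sum (map-cong (λ _ → sum-zeros (allFin n)) (allFin n))) (sum-zeros (allFin n))

no-cut-with-one-part : ∀ {n k} (G : Graph n) → k ≥ 1 → ¬ CutExists G 1 k
no-cut-with-one-part G k≥1 (p , good)
  with ≤-trans k≥1 (≤-trans good (≤-reflexive (one-part-cuts-nothing G p)))
... | ()

-- Exhaustive search over partitions.

_◂_ : ∀ {n t} → Fin t → (Fin n → Fin t) → Fin (suc n) → Fin t
(c ◂ q) zero    = c
(c ◂ q) (suc i) = q i

◂-cong : ∀ {n t} c {q q' : Fin n → Fin t} → (∀ i → q i ≡ q' i) → ∀ i → (c ◂ q) i ≡ (c ◂ q') i
◂-cong c q≗q' zero    = refl
◂-cong c q≗q' (suc i) = q≗q' i

◂-split : ∀ {n t} (p : Fin (suc n) → Fin t) → ∀ i → p i ≡ (p zero ◂ (λ j → p (suc j))) i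
◂-split p zero    = refl
◂-split p (suc i) = refl

∃-colouring? : ∀ n {t} (P : (Fin n → Fin t) → Set) →
               (∀ {p q} → (∀ i → p i ≡ q i) → P p → P q) → (∀ p → Dec (P p)) → Dec (∃ P)
∃-colouring? zero P resp P? with P? (λ ())
... | yes Pp = yes (_ , Pp)
... | no ¬Pp = no λ { (p , Pp) → ¬Pp (resp (λ ()) Pp) }
∃-colouring? (suc n) P resp P?
  with any? (λ c → ∃-colouring? n (λ q → P (c ◂ q)) (λ q≗q' → resp (◂-cong c q≗q'))
                                 (λ q → P? (c ◂ q)))
... | yes (c , q , Pq) = yes (c ◂ q , Pq)
... | no none          = no λ { (p , Pp) → none (p zero , (λ i → p (suc i)) , resp (◂-split p) Pp) }

good-partition? : ∀ {n} t k (f : Fin n → Fin n → Bool) →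
                  Dec (∃ λ (p : Fin n → Fin t) → k ≤ cutCount f p)
good-partition? {n} t k f = ∃-colouring? n (λ p → k ≤ cutCount f p)
  (λ p≗q → subst (k ≤_) (cutCount-cong (λ _ _ → refl) p≗q)) (λ p → k ≤? cutCount f p)

_>>=ˢ_ : ∀ {n} {R S : Set} → BISAlg n R → (R → BISAlg n S) → BISAlg n S
ret r     >>=ˢ f = f r
ask A B k >>=ˢ f = ask A B (λ b → k b >>=ˢ f)

_>>=ᵉ_ : ∀ {n} {R S : Set} → BISEAlg n R → (R → BISEAlg n S) → BISEAlg n S
ret r     >>=ᵉ f = f r
ask A B k >>=ᵉ f = ask A B (λ a → k a >>=ᵉ f)

module _ {n} (G : Graph n) where

  runs-weaken : ∀ {R} {P : R → Set} {α m m'} → m ≤ m' →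
                BISRunsWithin G P α m → BISRunsWithin G P α m'
  runs-weaken _          (ret Pr)      = ret Pr
  runs-weaken (s≤s m≤m') (ask valid k) = ask valid (λ b ans → runs-weaken m≤m' (k b ans))

  runs-map : ∀ {R} {P Q : R → Set} {α m} → (∀ r → P r → Q r) →
             BISRunsWithin G P α m → BISRunsWithin G Q α m
  runs-map P⇒Q (ret Pr)      = ret (P⇒Q _ Pr)
  runs-map P⇒Q (ask valid k) = ask valid (λ b ans → runs-map P⇒Q (k b ans))

  runs-bind : ∀ {R S} {P : R → Set} {Q : S → Set} {α : BISAlg n R} {f : R → BISAlg n S} {m m'} →
              BISRunsWithin G P α m → (∀ r → P r → BISRunsWithin G Q (f r) m') →
              BISRunsWithin G Q (α >>=ˢ f) (m + m')
  runs-bind {m = m} (ret Pr)      f-runs = runs-weaken (m≤n+m _ m) (f-runs _ Pr)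
  runs-bind         (ask valid k) f-runs = ask valid (λ b ans → runs-bind (k b ans) f-runs)

-- Costs G P α q s : every run of the BISE algorithm α against a correct oracle
-- for G makes only valid queries, at most q of them, at most s of which are
-- answered by an edge (and none once s edges have been returned), and ends with
-- an output satisfying P.  The second budget matters because a BIS simulation
-- pays extra only for the edge answers.
data Costs {n} {R : Set} (G : Graph n) (P : R → Set) : BISEAlg n R → ℕ → ℕ → Set where
  ret : ∀ {r q s} → P r → Costs G P (ret r) q s
  ask : ∀ {A B k q s} → ValidQuery A B →
        (¬ EdgeBetween G A B → Costs G P (k nothing) q (suc s)) →
        (∀ e → BISEAnswer G A B (just e) → Costs G P (k (just e)) q s) →
        Costs G P (ask A B k) (suc q) (suc s)

module _ {n} (G : Graph n) where

  costs-weaken : ∀ {R} {P : R → Set} {α q s q' s'} → q ≤ q' → s ≤ s' →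
                 Costs G P α q s → Costs G P α q' s'
  costs-weaken _          _          (ret Pr)               = ret Pr
  costs-weaken (s≤s q≤q') (s≤s s≤s') (ask valid none found) =
    ask valid (λ ¬e → costs-weaken q≤q' (s≤s s≤s') (none ¬e))
              (λ e ans → costs-weaken q≤q' s≤s' (found e ans))

  costs-map : ∀ {R} {P Q : R → Set} {α q s} → (∀ r → P r → Q r) →
              Costs G P α q s → Costs G Q α q s
  costs-map P⇒Q (ret Pr)               = ret (P⇒Q _ Pr)
  costs-map P⇒Q (ask valid none found) =
    ask valid (λ ¬e → costs-map P⇒Q (none ¬e)) (λ e ans → costs-map P⇒Q (found e ans))

  costs-bind : ∀ {R S} {P : R → Set} {Q : S → Set} {α : BISEAlg n R} {f : R → BISEAlg n S} {q s q' s'} →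
               Costs G P α q s → (∀ r → P r → Costs G Q (f r) q' s') →
               Costs G Q (α >>=ᵉ f) (q + q') (s + s')
  costs-bind {q = q} {s} (ret Pr) f-costs = costs-weaken (m≤n+m _ q) (m≤n+m _ s) (f-costs _ Pr)
  costs-bind (ask valid none found) f-costs =
    ask valid (λ ¬e → costs-bind (none ¬e) f-costs) (λ e ans → costs-bind (found e ans) f-costs)

  costs⇒runs : ∀ {R} {P : R → Set} {α q s} → Costs G P α q s → BISERunsWithin G P α q
  costs⇒runs (ret Pr)               = ret Pr
  costs⇒runs (ask valid none found) =
    ask valid λ { nothing ¬e → costs⇒runs (none ¬e) ; (just e) ans → costs⇒runs (found e ans) }

-- A BISE query on disjoint sets that answers NULL by itself when one of them is
-- empty, so that only valid queries reach the oracle.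
query : ∀ {n} → Subset n → Subset n → BISEAlg n (Maybe (Fin n × Fin n))
query A B with nonempty? A | nonempty? B | nonempty? (A ∩ B)
... | yes _ | yes _ | no _ = ask A B ret
... | _     | _     | _    = ret nothing

query-costs : ∀ {n} (G : Graph n) {R} {P : R → Set} (A B : Subset n)
                {f : Maybe (Fin n × Fin n) → BISEAlg n R} {q s} →
              Empty (A ∩ B) →
              (¬ EdgeBetween G A B → Costs G P (f nothing) q (suc s)) →
              (∀ e → BISEAnswer G A B (just e) → Costs G P (f (just e)) q s) →
              Costs G P (query A B >>=ᵉ f) (suc q) (suc s)
query-costs G A B disjoint none found with nonempty? A | nonempty? B | nonempty? (A ∩ B)
... | yes A≠∅ | yes B≠∅ | no A∩B=∅  = ask (A≠∅ , B≠∅ , A∩B=∅) none found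
... | yes _   | yes _   | yes A∩B≠∅ = ⊥-elim (disjoint A∩B≠∅)
... | yes _   | no B=∅  | _          =
  costs-weaken G (n≤1+n _) ≤-refl (none λ { (_ , b , _ , b∈B , _) → B=∅ (b , b∈B) })
... | no A=∅  | _       | _          =
  costs-weaken G (n≤1+n _) ≤-refl (none λ { (a , _ , a∈A , _ , _) → A=∅ (a , a∈A) })

-- Finding an edge inside a vertex set U with one BISE query per bit: an edge
-- whose endpoints differ in bit i joins the two slices of U for bit i, and no
-- edge joins two vertices agreeing on all bits.  (U itself cannot be queried
-- against U, as oracle queries need disjoint sets.)

edgeInside : ∀ {n} → ℕ → Subset n → BISEAlg n (Maybe (Fin n × Fin n))
edgeInside zero    U = ret nothing
edgeInside (suc i) U = query (slice U i true) (slice U i false) >>=ᵉ λ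
  { nothing  → edgeInside i U
  ; (just e) → ret (just e) }

module _ {n} (G : Graph n) where

  -- After i unsuccessful queries, edges inside U join vertices agreeing on the bits below i.
  InsideAnswer : ℕ → Subset n → Maybe (Fin n × Fin n) → Set
  InsideAnswer i U nothing  =
    ∀ {a b} → a ∈ U → b ∈ U → adj G a b ≡ true → ∀ j → j < i → bit j a ≡ bit j b
  InsideAnswer i U (just e) = BISEAnswer G U U (just e)

  same-bit : ∀ {U} i → ¬ EdgeBetween G (slice U i true) (slice U i false) →
             ∀ {a b} → a ∈ U → b ∈ U → adj G a b ≡ true → bit i a ≡ bit i b
  same-bit i ¬edge {a} {b} a∈U b∈U ab with bit i a in ea | bit i b in eb
  ... | true  | true  = refl
  ... | false | false = refl
  ... | true  | false = ⊥-elim (¬edge (a , b , slice⁺ i a∈U ea , slice⁺ i b∈U eb , ab))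
  ... | false | true  =
    ⊥-elim (¬edge (b , a , slice⁺ i b∈U eb , slice⁺ i a∈U ea , trans (adj-sym G b a) ab))

  edgeInside-invariant : ∀ i U → Costs G (InsideAnswer i U) (edgeInside i U) i 1
  edgeInside-invariant zero    U = ret λ _ _ _ j ()
  edgeInside-invariant (suc i) U =
    query-costs G (slice U i true) (slice U i false) (slices-disjoint U U i)
      (λ ¬edge → costs-map G (extend ¬edge) (edgeInside-invariant i U))
      (λ { (a , b) (a∈ , b∈ , ab) → ret (slice-⊆ U i true a∈ , slice-⊆ U i false b∈ , ab) })
    where
      extend : ¬ EdgeBetween G (slice U i true) (slice U i false) →
               ∀ r → InsideAnswer i U r → InsideAnswer (suc i) U r
      extend ¬edge nothing agree a∈U b∈U ab j j<1+i with m<1+n⇒m<n∨m≡n j<1+i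
      ... | inj₁ j<i  = agree a∈U b∈U ab j j<i
      ... | inj₂ refl = same-bit i ¬edge a∈U b∈U ab
      extend ¬edge (just e) ans = ans

  edgeInside-costs : ∀ U → Costs G (BISEAnswer G U U) (edgeInside ⌈log₂ n ⌉ U) ⌈log₂ n ⌉ 1
  edgeInside-costs U = costs-map G answer (edgeInside-invariant ⌈log₂ n ⌉ U)
    where
      answer : ∀ r → InsideAnswer ⌈log₂ n ⌉ U r → BISEAnswer G U U r
      answer nothing  agree (a , b , a∈U , b∈U , ab) =
        edge-ends-differ G ab (bits-separate a b (agree a∈U b∈U ab))
      answer (just e) ans = ans

-- The BISE algorithm for Cut with t + 2 ≥ 2 parts; the partitions it builds
-- only use parts 0 and 1.

module BISECut {n : ℕ} (t k : ℕ) where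

  open import Data.List.Membership.DecPropositional (_≟_ {n}) using (_∈?_)
  open import Data.List.Membership.DecPropositional (_≟²_ {n}) using () renaming (_∈?_ to _∈²?_)

  Partition : Set
  Partition = Fin n → Fin (suc (suc t))

  part₀ part₁ : Fin (suc (suc t))
  part₀ = zero
  part₁ = suc zero

  Edge : Set
  Edge = Fin n × Fin n

  outside : List (Fin n) → Subset n
  outside xs = ⟦ (λ x → not (does (x ∈? xs))) ⟧

  outside⁺ : ∀ {xs x} → x ∉ˡ xs → x ∈ outside xs
  outside⁺ {xs} {x} x∉ = ∈⟦⟧⁺ (not-does⁺ (x ∈? xs) x∉)

  outside⁻ : ∀ xs {x} → x ∈ outside xs → x ∉ˡ xs
  outside⁻ xs {x} x∈ = not-does⁻ (x ∈? xs) (∈⟦⟧⁻ x∈)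

  endpoints : List Edge → List (Fin n)
  endpoints []            = []
  endpoints ((a , b) ∷ M) = a ∷ b ∷ endpoints M

  endpoints-length : ∀ M → length (endpoints M) ≡ length M + length M
  endpoints-length []            = refl
  endpoints-length ((a , b) ∷ M) =
    cong suc (trans (cong suc (endpoints-length M)) (sym (+-suc (length M) (length M))))

  -- Sequencing of phases that may stop early with a good cut.
  _>>=ᶜ_ : ∀ {X Y : Set} → BISEAlg n (Partition ⊎ X) → (X → BISEAlg n (Partition ⊎ Y)) →
           BISEAlg n (Partition ⊎ Y)
  α >>=ᶜ f = α >>=ᵉ λ { (inj₁ p) → ret (inj₁ p) ; (inj₂ x) → f x }

  moveToPart₁ : Partition → Fin n → Partition
  moveToPart₁ p b x = if does (x ≟ b) then part₁ else p x

  -- Phase 1.  Greedily extend a matching M by edges between unmatched vertices,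
  -- putting second endpoints into part 1, until r more edges are found (then
  -- the partition cuts all k matching edges) or the unmatched vertices are
  -- independent (then the at most 2k matched vertices cover all edges).
  greedyMatching : ℕ → Partition → List Edge → BISEAlg n (Partition ⊎ List Edge)
  greedyStep     : ℕ → Partition → List Edge → Maybe Edge → BISEAlg n (Partition ⊎ List Edge)
  greedyMatching zero    p M = ret (inj₁ p)
  greedyMatching (suc r) p M = edgeInside ⌈log₂ n ⌉ (outside (endpoints M)) >>=ᵉ greedyStep r p M
  greedyStep r p M nothing        = ret (inj₂ M)
  greedyStep r p M (just (a , b)) = greedyMatching r (moveToPart₁ p b) ((a , b) ∷ M)

  star : Fin n → Partition
  star s x = if does (x ≟ s) then part₁ else part₀

  -- Phase 2.  List the neighbours of s, one query per neighbour; once k of them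
  -- are found, the star partition of s is a good cut.
  neighbours : Fin n → ℕ → List (Fin n) → BISEAlg n (Partition ⊎ List (Fin n))
  neighbours s zero    F = ret (inj₁ (star s))
  neighbours s (suc r) F = query ⁅ s ⁆ (outside (s ∷ F)) >>=ᵉ λ
    { nothing        → ret (inj₂ F)
    ; (just (_ , v)) → neighbours s r (v ∷ F) }

  edgesAt : List (Fin n) → BISEAlg n (Partition ⊎ List Edge)
  edgesAt []      = ret (inj₂ [])
  edgesAt (s ∷ S) = neighbours s k [] >>=ᶜ λ F → edgesAt S >>=ᶜ λ E → ret (inj₂ (map (s ,_) F ++ E))

  learnEdges : BISEAlg n (Partition ⊎ List Edge)
  learnEdges = greedyMatching k (λ _ → part₀) [] >>=ᶜ λ M → edgesAt (endpoints M)

  spannedBy : List Edge → Fin n → Fin n → Bool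
  spannedBy E u v = does ((u , v) ∈²? E) ∨ does ((v , u) ∈²? E)

  bestPartition : List Edge → Maybe Partition
  bestPartition E with good-partition? (suc (suc t)) k (spannedBy E)
  ... | yes (p , _) = just p
  ... | no  _       = nothing

  cut : BISEAlg n (Maybe Partition)
  cut = learnEdges >>=ᵉ λ
    { (inj₁ p) → ret (just p)
    ; (inj₂ E) → ret (bestPartition E) }

  module _ (G : Graph n) where

    GoodResult : ∀ {X : Set} → (X → Set) → Partition ⊎ X → Set
    GoodResult Q (inj₁ p) = GoodCut G (suc (suc t)) k p
    GoodResult Q (inj₂ x) = Q x

    costs-bind-cut : ∀ {X Y} {Q : X → Set} {Q' : Y → Set} {α : BISEAlg n (Partition ⊎ X)}
                       {f : X → BISEAlg n (Partition ⊎ Y)} {q s q' s'} →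
                     Costs G (GoodResult Q) α q s → (∀ x → Q x → Costs G (GoodResult Q') (f x) q' s') →
                     Costs G (GoodResult Q') (α >>=ᶜ f) (q + q') (s + s')
    costs-bind-cut α-costs f-costs = costs-bind G α-costs λ
      { (inj₁ p) good → ret good
      ; (inj₂ x) Qx   → f-costs x Qx }

    -- The Phase 1 invariant, with r rounds left: M is a matching of cut edges
    -- and the unmatched vertices are in part 0.
    record Matching (r : ℕ) (p : Partition) (M : List Edge) : Set where
      field
        cut-edges     : All (CutEdge G p) M
        distinct      : AllPairs _≢ᵤ_ M
        rest-in-part₀ : ∀ {x} → x ∉ˡ endpoints M → p x ≡ part₀
        size          : length M + r ≡ k
    open Matching

    Covers : List Edge → Set
    Covers M = ∀ {u v} → adj G u v ≡ true → u ∈ˡ endpoints M ⊎ v ∈ˡ endpoints M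

    Phase1Result : Partition ⊎ List Edge → Set
    Phase1Result = GoodResult (λ M → Covers M × length M ≤ k)

    avoids : ∀ {x} M → x ∉ˡ endpoints M → All (λ e → x ≢ proj₁ e × x ≢ proj₂ e) M
    avoids []            _  = []
    avoids ((a , b) ∷ M) x∉ =
      ((λ x≡a → x∉ (here x≡a)) , (λ x≡b → x∉ (there (here x≡b))))
      ∷ avoids M (λ x∈ → x∉ (there (there x∈)))

    moved : ∀ p b → moveToPart₁ p b b ≡ part₁
    moved p b rewrite dec-true (b ≟ b) refl = refl

    not-moved : ∀ p {b x} → x ≢ b → moveToPart₁ p b x ≡ p x
    not-moved p {b} {x} x≢b rewrite dec-false (x ≟ b) x≢b = refl

    matching-step : ∀ {r p M a b} → Matching (suc r) p M → a ∉ˡ endpoints M → b ∉ˡ endpoints M →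
                    adj G a b ≡ true → Matching r (moveToPart₁ p b) ((a , b) ∷ M)
    matching-step {r} {p} {M} {a} {b} inv a∉ b∉ ab = record
      { cut-edges     = (ab , new-edge-cut) ∷ All.zipWith still-cut (cut-edges inv , avoids M b∉)
      ; distinct      = All.map new-edge-distinct (avoids M a∉) ∷ distinct inv
      ; rest-in-part₀ = λ x∉ → trans (not-moved p (λ x≡b → x∉ (there (here x≡b))))
                                     (rest-in-part₀ inv (λ x∈ → x∉ (there (there x∈))))
      ; size          = trans (sym (+-suc (length M) r)) (size inv) }
      where
        new-edge-cut : moveToPart₁ p b a ≢ moveToPart₁ p b b
        new-edge-cut eq
          with trans (sym (trans (not-moved p (edge-ends-differ G ab)) (rest-in-part₀ inv a∉)))
                     (trans eq (moved p b))
        ... | ()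
        new-edge-distinct : ∀ {e} → a ≢ proj₁ e × a ≢ proj₂ e → (a , b) ≢ᵤ e
        new-edge-distinct (a≢c , a≢d) = (λ eq → a≢c (cong proj₁ eq)) , (λ eq → a≢d (cong proj₁ eq))
        still-cut : ∀ {e} → CutEdge G p e × (b ≢ proj₁ e × b ≢ proj₂ e) → CutEdge G (moveToPart₁ p b) e
        still-cut {c , d} ((cd , pc≢pd) , b≢c , b≢d) =
          cd , λ eq → pc≢pd (trans (sym (not-moved p (λ c≡b → b≢c (sym c≡b))))
                                   (trans eq (not-moved p (λ d≡b → b≢d (sym d≡b)))))

    covers : ∀ M → ¬ EdgeBetween G (outside (endpoints M)) (outside (endpoints M)) → Covers M
    covers M ¬edge {u} {v} uv with u ∈? endpoints M | v ∈? endpoints M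
    ... | yes u∈ | _      = inj₁ u∈
    ... | no  _  | yes v∈ = inj₂ v∈
    ... | no  u∉ | no  v∉ = ⊥-elim (¬edge (u , v , outside⁺ u∉ , outside⁺ v∉ , uv))

    greedyMatching-costs : ∀ r {p M} → Matching r p M →
                           Costs G Phase1Result (greedyMatching r p M) (r * ⌈log₂ n ⌉) r
    greedyMatching-costs zero {p} {M} inv =
      ret (subst (_≤ cutSize G p) (trans (sym (+-identityʳ (length M))) (size inv))
                 (cut-lower-bound G p M (cut-edges inv) (distinct inv)))
    greedyMatching-costs (suc r) {p} {M} inv =
      costs-bind G (edgeInside-costs G (outside (endpoints M))) next
      where
        next : ∀ ans → BISEAnswer G (outside (endpoints M)) (outside (endpoints M)) ans →
               Costs G Phase1Result (greedyStep r p M ans) (r * ⌈log₂ n ⌉) r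
        next nothing        ¬edge          =
          ret (covers M ¬edge , subst (length M ≤_) (size inv) (m≤m+n (length M) (suc r)))
        next (just (a , b)) (a∈ , b∈ , ab) =
          greedyMatching-costs r
            (matching-step inv (outside⁻ (endpoints M) a∈) (outside⁻ (endpoints M) b∈) ab)

    record Neighbours (s : Fin n) (r : ℕ) (F : List (Fin n)) : Set where
      field
        adjacent : All (λ v → adj G s v ≡ true) F
        distinct : AllPairs _≢_ F
        size     : length F + r ≡ k
    open Neighbours

    NeighbourhoodOf : Fin n → List (Fin n) → Set
    NeighbourhoodOf s F = All (λ v → adj G s v ≡ true) F × (∀ {v} → adj G s v ≡ true → v ∈ˡ F)

    star-cut : ∀ s {F} → All (λ v → adj G s v ≡ true) F → AllPairs _≢_ F →
               length F ≤ cutSize G (star s)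
    star-cut s {F} adjacent distinct = subst (_≤ cutSize G (star s)) (length-map (s ,_) F)
      (cut-lower-bound G (star s) (map (s ,_) F)
        (All.map⁺ (All.map (λ sv → sv , separated sv) adjacent))
        (AllPairs.map⁺ (AllPairs.map star-edges-distinct distinct)))
      where
        separated : ∀ {v} → adj G s v ≡ true → star s s ≢ star s v
        separated {v} sv
          rewrite dec-true (s ≟ s) refl | dec-false (v ≟ s) (λ v≡s → edge-ends-differ G sv (sym v≡s))
          = λ ()
        star-edges-distinct : ∀ {v v'} → v ≢ v' → (s , v) ≢ᵤ (s , v')
        star-edges-distinct v≢v' = (λ eq → v≢v' (cong proj₂ eq)) ,
                                   (λ eq → v≢v' (trans (cong proj₂ eq) (cong proj₁ eq)))

    neighbours-costs : ∀ s r {F} → Neighbours s r F →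
                       Costs G (GoodResult (NeighbourhoodOf s)) (neighbours s r F) r r
    neighbours-costs s zero {F} inv =
      ret (subst (_≤ cutSize G (star s)) (trans (sym (+-identityʳ (length F))) (size inv))
                 (star-cut s (adjacent inv) (distinct inv)))
    neighbours-costs s (suc r) {F} inv = query-costs G ⁅ s ⁆ (outside (s ∷ F)) s-listed complete found
      where
        s-listed : Empty (⁅ s ⁆ ∩ outside (s ∷ F))
        s-listed (x , x∈) with x∈⁅y⁆⇒x≡y s (proj₁ (x∈p∩q⁻ ⁅ s ⁆ _ x∈))
        ... | refl = outside⁻ (s ∷ F) (proj₂ (x∈p∩q⁻ ⁅ s ⁆ _ x∈)) (here refl)
        complete : ¬ EdgeBetween G ⁅ s ⁆ (outside (s ∷ F)) →
                   Costs G (GoodResult (NeighbourhoodOf s)) (ret (inj₂ F)) r (suc r)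
        complete ¬edge = ret (adjacent inv , λ {v} → listed {v})
          where
            listed : ∀ {v} → adj G s v ≡ true → v ∈ˡ F
            listed {v} sv with v ∈? F
            ... | yes v∈ = v∈
            ... | no  v∉ = ⊥-elim (¬edge (s , v , x∈⁅x⁆ s , outside⁺ new , sv))
              where
                new : v ∉ˡ s ∷ F
                new (here v≡s) = edge-ends-differ G sv (sym v≡s)
                new (there v∈) = v∉ v∈
        found : ∀ e → BISEAnswer G ⁅ s ⁆ (outside (s ∷ F)) (just e) →
                Costs G (GoodResult (NeighbourhoodOf s)) (neighbours s r (proj₂ e ∷ F)) r r
        found (s' , v) (s'∈ , v∈ , s'v) with x∈⁅y⁆⇒x≡y s s'∈
        ... | refl = neighbours-costs s r record
          { adjacent = s'v ∷ adjacent inv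
          ; distinct = ¬Any⇒All¬ F (λ v∈F → outside⁻ (s ∷ F) v∈ (there v∈F)) ∷ distinct inv
          ; size     = trans (sym (+-suc (length F) r)) (size inv) }

    EdgesAt : List (Fin n) → List Edge → Set
    EdgesAt S E = All (λ e → adj G (proj₁ e) (proj₂ e) ≡ true) E ×
                  (∀ {s v} → s ∈ˡ S → adj G s v ≡ true → (s , v) ∈ˡ E)

    edgesAt-costs : ∀ S → Costs G (GoodResult (EdgesAt S)) (edgesAt S) (length S * k) (length S * k)
    edgesAt-costs []      = ret ([] , λ ())
    edgesAt-costs (s ∷ S) =
      costs-bind-cut (neighbours-costs s k (record { adjacent = [] ; distinct = [] ; size = refl }))
        λ F (adjF , allF) → costs-weaken G (≤-reflexive (+-identityʳ _)) (≤-reflexive (+-identityʳ _))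
          (costs-bind-cut (edgesAt-costs S)
            λ E (adjE , allE) → ret (All.++⁺ (All.map⁺ adjF) adjE , all allF allE))
      where
        all : ∀ {F E} → (∀ {v} → adj G s v ≡ true → v ∈ˡ F) →
              (∀ {s' v} → s' ∈ˡ S → adj G s' v ≡ true → (s' , v) ∈ˡ E) →
              ∀ {s' v} → s' ∈ˡ s ∷ S → adj G s' v ≡ true → (s' , v) ∈ˡ map (s ,_) F ++ E
        all     allF allE (here refl) sv = ∈-++⁺ˡ (∈-map⁺ (s ,_) (allF sv))
        all {F} allF allE (there s'∈) sv = ∈-++⁺ʳ (map (s ,_) F) (allE s'∈ sv)

    Spans : List Edge → Set
    Spans E = ∀ u v → spannedBy E u v ≡ adj G u v

    spannedBy-adj : ∀ {M E} → Covers M → EdgesAt (endpoints M) E → Spans E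
    spannedBy-adj {M} {E} cover (edges , all) u v with (u , v) ∈²? E | (v , u) ∈²? E
    ... | yes uv∈ | _       = sym (All.lookup edges uv∈)
    ... | no  _   | yes vu∈ = sym (trans (adj-sym G u v) (All.lookup edges vu∈))
    ... | no  uv∉ | no  vu∉ with adj G u v in uv
    ...   | false = refl
    ...   | true with cover uv
    ...     | inj₁ u∈ = ⊥-elim (uv∉ (all u∈ uv))
    ...     | inj₂ v∈ = ⊥-elim (vu∉ (all v∈ (trans (adj-sym G v u) uv)))

    bestPartition-correct : ∀ E → Spans E → CutCorrect G (suc (suc t)) k (bestPartition E)
    bestPartition-correct E spans with good-partition? (suc (suc t)) k (spannedBy E)
    ... | yes (p , good) = subst (k ≤_) (cutCount-cong spans (λ _ → refl)) good
    ... | no  none       =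
      λ { (p , good) → none (p , subst (k ≤_) (cutCount-cong unspans (λ _ → refl)) good) }
      where
        unspans : ∀ u v → adj G u v ≡ spannedBy E u v
        unspans u v = sym (spans u v)

    learnEdges-costs : Costs G (GoodResult Spans) learnEdges (k * ⌈log₂ n ⌉ + (k + k) * k) (k + (k + k) * k)
    learnEdges-costs =
      costs-bind-cut (greedyMatching-costs k empty-matching) λ M (cover , small) →
        costs-weaken G (phase2-bound M small) (phase2-bound M small)
          (costs-map G (λ { (inj₁ p) good → good ; (inj₂ E) edges → spannedBy-adj cover edges })
                       (edgesAt-costs (endpoints M)))
      where
        empty-matching : Matching k (λ _ → part₀) []
        empty-matching = record { cut-edges = [] ; distinct = [] ; rest-in-part₀ = λ _ → refl ; size = refl }
        phase2-bound : ∀ M → length M ≤ k → length (endpoints M) * k ≤ (k + k) * k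
        phase2-bound M small = subst (λ l → l * k ≤ (k + k) * k) (sym (endpoints-length M))
                                     (*-monoˡ-≤ k (+-mono-≤ small small))

    cut-costs : Costs G (CutCorrect G (suc (suc t)) k) cut (k * ⌈log₂ n ⌉ + (k + k) * k) (k + (k + k) * k)
    cut-costs = costs-weaken G (≤-reflexive (+-identityʳ _)) (≤-reflexive (+-identityʳ _))
      (costs-bind G learnEdges-costs λ
        { (inj₁ p) good  → ret good
        ; (inj₂ E) spans → ret (bestPartition-correct E spans) })

-- Simulating the BISE oracle by the BIS oracle.

module _ {n : ℕ} where

  -- Binary search for a vertex of Y with a neighbour in X: split Y by bit i and
  -- ask which half is joined to X.
  locate : ℕ → Subset n → Subset n → BISAlg n (Maybe (Fin n))
  locate zero X Y with nonempty? Y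
  ... | yes (y , _) = ret (just y)
  ... | no  _       = ret nothing
  locate (suc i) X Y with nonempty? (slice Y i true)
  ... | yes _ = ask X (slice Y i true) λ
                  { true  → locate i X (slice Y i true)
                  ; false → locate i X (slice Y i false) }
  ... | no  _ = locate i X (slice Y i false)

  -- An edge between A and B: locate its end b in B, then a neighbour of b in A.
  findEdge : Subset n → Subset n → BISAlg n (Maybe (Fin n × Fin n))
  findEdge A B = locate ⌈log₂ n ⌉ A B >>=ˢ λ
    { nothing  → ret nothing
    ; (just b) → locate ⌈log₂ n ⌉ ⁅ b ⁆ A >>=ˢ λ
        { nothing  → ret nothing
        ; (just a) → ret (just (a , b)) } }

  simulate : ∀ {R} → BISEAlg n R → BISAlg n R
  simulate (ret r)     = ret r
  simulate (ask A B k) = ask A B λ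
    { true  → findEdge A B >>=ˢ λ e → simulate (k e)
    ; false → simulate (k nothing) }

module _ {n} (G : Graph n) where

  AgreeFrom : ℕ → Subset n → Set
  AgreeFrom i Y = ∀ {x y} → x ∈ Y → y ∈ Y → ∀ j → i ≤ j → j < ⌈log₂ n ⌉ → bit j x ≡ bit j y

  agreeFrom-all : ∀ Y → AgreeFrom ⌈log₂ n ⌉ Y
  agreeFrom-all Y _ _ j L≤j j<L = ⊥-elim (<-irrefl refl (≤-<-trans L≤j j<L))

  agreeFrom-slice : ∀ {i Y} b → AgreeFrom (suc i) Y → AgreeFrom i (slice Y i b)
  agreeFrom-slice {i} {Y} b agree x∈ y∈ j i≤j j<L with m≤n⇒m<n∨m≡n i≤j
  ... | inj₁ i<j  = agree (proj₁ (slice⁻ Y i b x∈)) (proj₁ (slice⁻ Y i b y∈)) j i<j j<L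
  ... | inj₂ refl = trans (proj₂ (slice⁻ Y i b x∈)) (sym (proj₂ (slice⁻ Y i b y∈)))

  edge-to-other-half : ∀ i {X Y} → EdgeBetween G X Y → ¬ EdgeBetween G X (slice Y i true) →
                       EdgeBetween G X (slice Y i false)
  edge-to-other-half i (x , y , x∈ , y∈ , xy) ¬edge with bit i y in bit-y
  ... | true  = ⊥-elim (¬edge (x , y , x∈ , slice⁺ i y∈ bit-y , xy))
  ... | false = x , y , x∈ , slice⁺ i y∈ bit-y , xy

  Located : Subset n → Subset n → Maybe (Fin n) → Set
  Located X Y nothing  = ⊥
  Located X Y (just y) = y ∈ Y × ∃ λ x → x ∈ X × adj G x y ≡ true

  located-⊆ : ∀ {X Y Y'} → (∀ {z} → z ∈ Y' → z ∈ Y) → ∀ r → Located X Y' r → Located X Y r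
  located-⊆ Y'⊆Y (just y) (y∈ , nbr) = Y'⊆Y y∈ , nbr

  locate-runs : ∀ i X Y → Nonempty X → Empty (X ∩ Y) → EdgeBetween G X Y → AgreeFrom i Y →
                BISRunsWithin G (Located X Y) (locate i X Y) i

  locate-half : ∀ i b {X Y} → Nonempty X → Empty (X ∩ Y) → AgreeFrom (suc i) Y →
                EdgeBetween G X (slice Y i b) → BISRunsWithin G (Located X Y) (locate i X (slice Y i b)) i

  locate-runs zero X Y X≠∅ disjoint (x , y' , x∈ , y'∈ , xy') agree with nonempty? Y
  ... | yes (y , y∈) = ret (y∈ , x , x∈ , subst (λ z → adj G x z ≡ true) y'≡y xy')
    where
      y'≡y : y' ≡ y
      y'≡y = bits-separate y' y (λ j j<L → agree y'∈ y∈ j z≤n j<L)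
  ... | no  Y=∅      = ⊥-elim (Y=∅ (y' , y'∈))
  locate-runs (suc i) X Y X≠∅ disjoint edge agree with nonempty? (slice Y i true)
  ... | yes Y₁≠∅ = ask (X≠∅ , Y₁≠∅ , disjoint-⊆ disjoint (slice-⊆ Y i true)) λ
      { true  edge₁  → locate-half i true X≠∅ disjoint agree edge₁
      ; false ¬edge₁ → locate-half i false X≠∅ disjoint agree (edge-to-other-half i edge ¬edge₁) }
  ... | no  Y₁=∅ = runs-weaken G (n≤1+n i) (locate-half i false X≠∅ disjoint agree
      (edge-to-other-half i edge (λ { (_ , y , _ , y∈ , _) → Y₁=∅ (y , y∈) })))

  locate-half i b {X} {Y} X≠∅ disjoint agree edge-b = runs-map G (located-⊆ (slice-⊆ Y i b))
    (locate-runs i X (slice Y i b) X≠∅ (disjoint-⊆ disjoint (slice-⊆ Y i b)) edge-b (agreeFrom-slice b agree))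

  findEdge-runs : ∀ {A B} → ValidQuery A B → EdgeBetween G A B →
                  BISRunsWithin G (BISEAnswer G A B) (findEdge A B) (2 * ⌈log₂ n ⌉)
  findEdge-runs {A} {B} (A≠∅ , _ , disjoint) edge =
    runs-bind G (locate-runs ⌈log₂ n ⌉ A B A≠∅ disjoint edge (agreeFrom-all B)) λ
      { (just b) (b∈ , x , x∈ , xb) → runs-bind G
          (locate-runs ⌈log₂ n ⌉ ⁅ b ⁆ A (b , x∈⁅x⁆ b) (singleton-disjoint b∈)
             (b , x , x∈⁅x⁆ b , x∈ , trans (adj-sym G b x) xb) (agreeFrom-all A)) λ
          { (just a) (a∈ , z , z∈ , za) →
              ret (a∈ , b∈ , trans (adj-sym G a b)
                                   (subst (λ w → adj G w a ≡ true) (x∈⁅y⁆⇒x≡y b z∈) za)) } }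
    where
      singleton-disjoint : ∀ {b} → b ∈ B → Empty (⁅ b ⁆ ∩ A)
      singleton-disjoint {b} b∈ (z , z∈) with x∈⁅y⁆⇒x≡y b (proj₁ (x∈p∩q⁻ ⁅ b ⁆ A z∈))
      ... | refl = disjoint (z , x∈p∩q⁺ (proj₂ (x∈p∩q⁻ ⁅ b ⁆ A z∈) , b∈))

  -- Each query costs 1, plus 2⌈log₂ n⌉ if it is answered by an edge.
  simulate-runs : ∀ {R} {P : R → Set} {α q s} → Costs G P α q s →
                  BISRunsWithin G P (simulate α) (q + s * (2 * ⌈log₂ n ⌉))
  simulate-runs (ret Pr) = ret Pr
  simulate-runs {q = suc q} {suc s} (ask valid none found) = ask valid λ
    { true  edge  → runs-weaken G (≤-reflexive (reorder (2 * ⌈log₂ n ⌉) q (s * (2 * ⌈log₂ n ⌉))))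
                      (runs-bind G (findEdge-runs valid edge) λ
                         { nothing  ¬edge → ⊥-elim (¬edge edge)
                         ; (just e) ans   → simulate-runs (found e ans) })
    ; false ¬edge → simulate-runs (none ¬edge) }
    where
      reorder : ∀ a b c → a + (b + c) ≡ b + (a + c)
      reorder = solve-∀

-- The Cut algorithm: with one part there is nothing to find.
cutAlg : (n t k : ℕ) → BISEAlg n (Maybe (Fin n → Fin t))
cutAlg n zero          k = ret nothing
cutAlg n (suc zero)    k = ret nothing
cutAlg n (suc (suc t)) k = BISECut.cut t k

cutAlg-costs : ∀ n t k → t ≥ 1 → k ≥ 1 → (G : Graph n) →
  Costs G (CutCorrect G t k) (cutAlg n t k) (k * ⌈log₂ n ⌉ + (k + k) * k) (k + (k + k) * k)
cutAlg-costs n (suc zero)    k _ k≥1 G = ret (no-cut-with-one-part G k≥1)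
cutAlg-costs n (suc (suc t)) k _ _   G = BISECut.cut-costs t k G

decisionAlg : (n t k : ℕ) → BISAlg n Bool
decisionAlg n t k = simulate (cutAlg n t k >>=ᵉ λ r → ret (is-just r))

decisionAlg-runs : ∀ n t k → t ≥ 1 → k ≥ 1 → (G : Graph n) →
  BISRunsWithin G (DecisionCutCorrect G t k) (decisionAlg n t k)
    ((k * ⌈log₂ n ⌉ + (k + k) * k + 0) + (k + (k + k) * k + 0) * (2 * ⌈log₂ n ⌉))
decisionAlg-runs n t k t≥1 k≥1 G = simulate-runs G (costs-bind G (cutAlg-costs n t k t≥1 k≥1 G) λ
  { (just p) good → ret (p , good)
  ; nothing  none → ret none })

-- The polynomial bounds, for k = 1 + x and L = ⌈log₂ n⌉, are routine: each
-- bound is the cost plus a polynomial with nonnegative coefficients.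

≤-by-slack : ∀ {m n} slack → n ≡ m + slack → m ≤ n
≤-by-slack {m} slack n≡m+slack = subst (m ≤_) (sym n≡m+slack) (m≤m+n m slack)

cut-bound : ∀ x L → suc x * L + (suc x + suc x) * suc x ≤ 3 * suc x ^ 2 * (L + 1)
cut-bound x L = ≤-by-slack (suc x * (3 * x + 2) * L + suc x * suc x) (identity x L)
  where
    identity : ∀ x L → 3 * (suc x * (suc x * 1)) * (L + 1) ≡
                       suc x * L + (suc x + suc x) * suc x + (suc x * (3 * x + 2) * L + suc x * suc x)
    identity = solve-∀

decision-bound : ∀ x L →
  (suc x * L + (suc x + suc x) * suc x + 0) + (suc x + (suc x + suc x) * suc x + 0) * (2 * L)
    ≤ 7 * suc x ^ 2 * (L + 1)
decision-bound x L = ≤-by-slack (3 * x * suc x * L + 5 * suc x * suc x) (identity x L)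
  where
    identity : ∀ x L → 7 * (suc x * (suc x * 1)) * (L + 1) ≡
                       (suc x * L + (suc x + suc x) * suc x + 0)
                         + (suc x + (suc x + suc x) * suc x + 0) * (2 * L)
                         + (3 * x * suc x * L + 5 * suc x * suc x)
    identity = solve-∀

corollary3 :
    (∃ λ c → ∃ λ d → Σ ((n t k : ℕ) → BISAlg n Bool) λ alg →
       ∀ n t k → t ≥ 1 → k ≥ 1 → (G : Graph n) →
         BISRunsWithin G (DecisionCutCorrect G t k) (alg n t k) (queryBound c d k n))
    ×
    (∃ λ c → ∃ λ d → Σ ((n t k : ℕ) → BISEAlg n (Maybe (Fin n → Fin t))) λ alg →
       ∀ n t k → t ≥ 1 → k ≥ 1 → (G : Graph n) →
         BISERunsWithin G (CutCorrect G t k) (alg n t k) (queryBound c d k n))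
corollary3 = (7 , 2 , decisionAlg , decision) , (3 , 2 , cutAlg , cut)
  where
    decision : ∀ n t k → t ≥ 1 → k ≥ 1 → (G : Graph n) →
               BISRunsWithin G (DecisionCutCorrect G t k) (decisionAlg n t k) (queryBound 7 2 k n)
    decision n t (suc x) t≥1 k≥1 G =
      runs-weaken G (decision-bound x ⌈log₂ n ⌉) (decisionAlg-runs n t (suc x) t≥1 k≥1 G)
    cut : ∀ n t k → t ≥ 1 → k ≥ 1 → (G : Graph n) →
          BISERunsWithin G (CutCorrect G t k) (cutAlg n t k) (queryBound 3 2 k n)
    cut n t (suc x) t≥1 k≥1 G =
      costs⇒runs G (costs-weaken G (cut-bound x ⌈log₂ n ⌉) ≤-refl (cutAlg-costs n t (suc x) t≥1 k≥1 G))
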